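{- Let $E$ be a set and let some subsets of $E$ be designated as $\phi$-classes, such that $(E,\phi)$ is a geometrical system in the generalized sense of Whitehead (as defined in the context). Suppose moreover that $E$ is finite and $E$ is $\phi$-maximal. Then $E$ is a simple matroid whose closure operator is $u\mapsto \operatorname{cm}_\phi(u)$. Moreover, a subset of $E$ is a flat of this matroid if and only if it is an intersection of $\phi$-classes. The independent sets of the matroid are exactly the $\phi$-axial subsets of $E$ together with the empty set. Finally, the rank function of the matroid equals the $\phi$-dimension number on every nonempty subset of $E$.
   Context: Whitehead's terminology. Let $E$ be a set and let some subsets of $E$ be designated as $\phi$-classes. For $u\subseteq E$, the $\phi$-common region $\operatorname{cm}_\phi(u)$ is the intersection of all $\phi$-classes containing $u$ (the intersection of the empty family being $E$). Two subsets $u,v\subseteq E$ are $\phi$-equivalent if $\operatorname{cm}_\phi(u)=\operatorname{cm}_\phi(v)$. A nonempty set $u\subseteq E$ is $\phi$-prime if no proper subset of $u$ has the same $\phi$-common region as $u$. A $\phi$-prime set is $\phi$-axial if it has the largest cardinality among all $\phi$-prime sets having the same $\phi$-common region. For nonempty $u\subseteq E$, the $\phi$-dimension number $\dim_\phi(u)$ is the cardinality of a $\phi$-axial set that is $\phi$-equivalent to $u$. A nonempty set $u\subseteq E$ is $\phi$-maximal if every $\phi$-prime subset of $u$ that is $\phi$-equivalent to $u$ is $\phi$-axial. $(E,\phi)$ is a geometrical system in the generalized sense of Whitehead if: ($\lambda$) $E$ is a $\phi$-class; ($\mu$) for every $x\in E$ the singleton $\{x\}$ is a $\phi$-class; ($\nu'$)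 $\dim_\phi(E)$ is finite and $\operatorname{cm}_\phi(\emptyset)=\emptyset$; ($\pi$) for every $u\subseteq E$ and every $\phi$-axial subset $v$ of $\operatorname{cm}_\phi(u)$, there exists $w\subseteq E$ such that $v\cup w$ is $\phi$-axial and $\phi$-equivalent to $u$; ($\rho$) for all $\phi$-axial $u,v\subseteq E$ with $|u\cap v|\ge 2$, the set $u\cup v$ is $\phi$-maximal. A simple matroid is a matroid with no loops and no parallel pairs (every set of at most two elements is independent). -}

module Defs where

open import Data.Nat using (ℕ; _≤_)
open import Data.Bool using (Bool; T; not)
open import Data.Bool.Properties using (T?)
open import Data.Fin using (Fin)
open import Data.Fin.Subset
  using (Subset; _∈_; _∉_; _⊆_; _⊂_; _∩_; _∪_; _-_; ⁅_⁆; ∣_∣; ⊤; ⊥; Nonempty)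
open import Data.Fin.Subset.Properties using (anySubset?; _∈?_; _⊆?_)
open import Data.Vec using (tabulate)
open import Data.Product using (Σ; ∃; _×_)
open import Relation.Nullary using (¬_; does)
open import Relation.Nullary.Decidable using (_×-dec_; ¬?)
open import Relation.Binary.PropositionalEquality using (_≡_; _≢_)

private variable n : ℕ

Classes : ℕ → Set
Classes n = Subset n → Bool

-- φ-common region: intersection of all φ-classes containing u
-- (E = ⊤ if there are none).  x ∈ cm φ u iff no φ-class ⊇ u omits x.
cm : Classes n → Subset n → Subset n
cm φ u = tabulate λ x →
  not (does (anySubset? (λ c → T? (φ c) ×-dec (u ⊆? c) ×-dec ¬? (x ∈? c))))

Equiv : Classes n → Subset n → Subset n → Set
Equiv φ u v = cm φ u ≡ cm φ v

Prime : Classes n → Subset n → Set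
Prime φ u = Nonempty u × (∀ v → v ⊂ u → cm φ v ≢ cm φ u)

Axial : Classes n → Subset n → Set
Axial φ u = Prime φ u × (∀ v → Prime φ v → cm φ v ≡ cm φ u → ∣ v ∣ ≤ ∣ u ∣)

IsDim : Classes n → Subset n → ℕ → Set
IsDim φ u k = ∃ λ v → Axial φ v × Equiv φ v u × ∣ v ∣ ≡ k

Maximal : Classes n → Subset n → Set
Maximal φ u = Nonempty u ×
  (∀ v → v ⊆ u → Prime φ v → Equiv φ v u → Axial φ v)

record GeometricalSystem (φ : Classes n) : Set where
  field
    axλ  : T (φ ⊤)
    axμ  : ∀ x → T (φ ⁅ x ⁆)
    axν₁ : ∃ λ k → IsDim φ ⊤ k
    axν₂ : cm φ ⊥ ≡ ⊥
    axπ  : ∀ u v → v ⊆ cm φ u → Axial φ v →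
             ∃ λ w → Axial φ (v ∪ w) × Equiv φ (v ∪ w) u
    axρ  : ∀ u v → Axial φ u → Axial φ v → 2 ≤ ∣ u ∩ v ∣ → Maximal φ (u ∪ v)

record IsMatroidClosure (cl : Subset n → Subset n) : Set where
  field
    extensive   : ∀ X → X ⊆ cl X
    monotone    : ∀ X Y → X ⊆ Y → cl X ⊆ cl Y
    idempotent  : ∀ X → cl (cl X) ≡ cl X
    exchange    : ∀ X x y → y ∈ cl (X ∪ ⁅ x ⁆) → y ∉ cl X → x ∈ cl (X ∪ ⁅ y ⁆)

Independent : (Subset n → Subset n) → Subset n → Set
Independent cl I = ∀ x → x ∈ I → x ∉ cl (I - x)

Simple : (Subset n → Subset n) → Set
Simple {n} cl = ∀ (I : Subset n) → ∣ I ∣ ≤ 2 → Independent cl I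

Flat : (Subset n → Subset n) → Subset n → Set
Flat cl X = cl X ≡ X

IsRank : (Subset n → Subset n) → Subset n → ℕ → Set
IsRank cl X k = (∃ λ I → I ⊆ X × Independent cl I × ∣ I ∣ ≡ k)
              × (∀ I → I ⊆ X → Independent cl I → ∣ I ∣ ≤ k)

-- X is the intersection of some family 𝓕 of φ-classes
-- (the empty family having intersection E)
IntersectionOfClasses : Classes n → Subset n → Set₁
IntersectionOfClasses {n} φ X =
  Σ (Subset n → Set) λ 𝓕 → (∀ c → 𝓕 c → T (φ c))
    × (∀ x → (x ∈ X → ∀ c → 𝓕 c → x ∈ c) × ((∀ c → 𝓕 c → x ∈ c) → x ∈ X))

{-# OPTIONS --safe #-}
module Submission where

-- The independent sets of cm are ∅ and the φ-prime sets, and the heart of the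
-- matter is that every prime set is axial. This comes from the φ-maximality of
-- E: (π) extends an axial set A ⊆ cm p to an axial B with cm B = E, and since
-- B ⊆ cm ((B ─ A) ∪ p), a prime subset of (B ─ A) ∪ p spans E; it is axial by
-- maximality, so ∣ B ∣ ≤ ∣ B ─ A ∣ + ∣ p ∣, i.e. ∣ A ∣ ≤ ∣ p ∣. Hence an
-- independent set inside cm X has at most ∣ X ∣ elements; together with the
-- extension property (π) this yields the exchange axiom, and both rank and
-- dimension become the size of any prime subset spanning the given set.

open import Defs
open import Data.Nat using (ℕ; suc; _+_; _≤_; _<_; z≤n; s≤s)
open import Data.Nat.Induction using (<-wellFounded)
open import Data.Nat.Properties
  using (≤-reflexive; ≤-trans; ≤-antisym; ≤-pred; <-≤-trans; <⇒≱; ≰⇒>; +-suc; +-comm; +-monoʳ-≤; n≤1+n; +-cancelˡ-≤; module ≤-Reasoning)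
open import Data.Bool using (T; not)
open import Data.Bool.Properties using (T?)
open import Data.Fin using (Fin; _≟_)
open import Data.Fin.Properties using (any?)
open import Data.Fin.Subset
  using (Subset; _∈_; _∉_; _⊆_; _∪_; _─_; _-_; ⁅_⁆; ∣_∣; ⊤; ⊥; Nonempty; inside; outside)
open import Data.Fin.Subset.Properties
open import Data.Vec using ([]; _∷_; here; there; lookup)
open import Data.Vec.Properties using (lookup∘tabulate; []=⇒lookup; lookup⇒[]=)
open import Data.Product using (∃; _×_; _,_; proj₁; proj₂)
open import Data.Sum using (_⊎_; inj₁; inj₂; [_,_]′)
open import Function using (id; _∘_)
open import Function.Bundles using (_⇔_; mk⇔)
open import Induction.WellFounded using (Acc; acc)
open import Relation.Nullary using (Dec; yes; no; does)
open import Relation.Nullary.Decidable using (_×-dec_; ¬?; dec-true; dec-false; decidable-stable)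
open import Relation.Nullary.Negation using (contradiction)
open import Relation.Binary.PropositionalEquality
  using (_≡_; refl; sym; trans; cong; subst; module ≡-Reasoning)

private variable n : ℕ

∣p∪q∣≤∣p∣+∣q∣ : ∀ (p q : Subset n) → ∣ p ∪ q ∣ ≤ ∣ p ∣ + ∣ q ∣
∣p∪q∣≤∣p∣+∣q∣ []            []            = z≤n
∣p∪q∣≤∣p∣+∣q∣ (outside ∷ p) (outside ∷ q) = ∣p∪q∣≤∣p∣+∣q∣ p q
∣p∪q∣≤∣p∣+∣q∣ (outside ∷ p) (inside ∷ q)  =
  ≤-trans (s≤s (∣p∪q∣≤∣p∣+∣q∣ p q)) (≤-reflexive (sym (+-suc ∣ p ∣ ∣ q ∣)))
∣p∪q∣≤∣p∣+∣q∣ (inside ∷ p)  (outside ∷ q) = s≤s (∣p∪q∣≤∣p∣+∣q∣ p q)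
∣p∪q∣≤∣p∣+∣q∣ (inside ∷ p)  (inside ∷ q)  =
  s≤s (≤-trans (∣p∪q∣≤∣p∣+∣q∣ p q) (+-monoʳ-≤ ∣ p ∣ (n≤1+n ∣ q ∣)))

q⊆p⇒∣p─q∣+∣q∣≡∣p∣ : ∀ (p q : Subset n) → q ⊆ p → ∣ p ─ q ∣ + ∣ q ∣ ≡ ∣ p ∣
q⊆p⇒∣p─q∣+∣q∣≡∣p∣ []            []            _   = refl
q⊆p⇒∣p─q∣+∣q∣≡∣p∣ (outside ∷ p) (outside ∷ q) q⊆p = q⊆p⇒∣p─q∣+∣q∣≡∣p∣ p q (drop-∷-⊆ q⊆p)
q⊆p⇒∣p─q∣+∣q∣≡∣p∣ (inside ∷ p)  (outside ∷ q) q⊆p = cong suc (q⊆p⇒∣p─q∣+∣q∣≡∣p∣ p q (drop-∷-⊆ q⊆p))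
q⊆p⇒∣p─q∣+∣q∣≡∣p∣ (outside ∷ p) (inside ∷ q)  q⊆p = contradiction (q⊆p here) λ ()
q⊆p⇒∣p─q∣+∣q∣≡∣p∣ (inside ∷ p)  (inside ∷ q)  q⊆p =
  trans (+-suc ∣ p ─ q ∣ ∣ q ∣) (cong suc (q⊆p⇒∣p─q∣+∣q∣≡∣p∣ p q (drop-∷-⊆ q⊆p)))

p⊆q∧∣q∣≤∣p∣⇒p≡q : ∀ {p q : Subset n} → p ⊆ q → ∣ q ∣ ≤ ∣ p ∣ → p ≡ q
p⊆q∧∣q∣≤∣p∣⇒p≡q {p = []}          {[]}          _   _ = refl
p⊆q∧∣q∣≤∣p∣⇒p≡q {p = outside ∷ p} {outside ∷ q} p⊆q ∣q∣≤∣p∣ =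
  cong (outside ∷_) (p⊆q∧∣q∣≤∣p∣⇒p≡q (drop-∷-⊆ p⊆q) ∣q∣≤∣p∣)
p⊆q∧∣q∣≤∣p∣⇒p≡q {p = inside ∷ p}  {inside ∷ q}  p⊆q ∣q∣≤∣p∣ =
  cong (inside ∷_) (p⊆q∧∣q∣≤∣p∣⇒p≡q (drop-∷-⊆ p⊆q) (≤-pred ∣q∣≤∣p∣))
p⊆q∧∣q∣≤∣p∣⇒p≡q {p = inside ∷ p}  {outside ∷ q} p⊆q _ = contradiction (p⊆q here) λ ()
p⊆q∧∣q∣≤∣p∣⇒p≡q {p = outside ∷ p} {inside ∷ q}  p⊆q ∣q∣<∣p∣ =
  contradiction (p⊆q⇒∣p∣≤∣q∣ (drop-∷-⊆ p⊆q)) (<⇒≱ ∣q∣<∣p∣)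

x∈p─q⁻ : ∀ (p q : Subset n) {x} → x ∈ p ─ q → x ∈ p × x ∉ q
x∈p─q⁻ (_ ∷ p)      (inside ∷ q)  {Fin.zero} ()
x∈p─q⁻ (inside ∷ p) (outside ∷ q) {Fin.zero} here = here , λ ()
x∈p─q⁻ (_ ∷ p)      (_ ∷ q)       {Fin.suc x} (there x∈p─q) =
  there (proj₁ (x∈p─q⁻ p q x∈p─q)) , proj₂ (x∈p─q⁻ p q x∈p─q) ∘ drop-there

IsRank-unique : ∀ (cl : Subset n → Subset n) {X j k} → IsRank cl X j → IsRank cl X k → j ≡ k
IsRank-unique _ ((I , I⊆X , I-indep , refl) , I-max) ((J , J⊆X , J-indep , refl) , J-max) =
  ≤-antisym (J-max I I⊆X I-indep) (I-max J J⊆X J-indep)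

module Closure (φ : Classes n) where

  private
    Escapes : Subset n → Fin n → Set
    Escapes u x = ∃ λ c → T (φ c) × u ⊆ c × x ∉ c

    escapes? : ∀ u x → Dec (Escapes u x)
    escapes? u x = anySubset? (λ c → T? (φ c) ×-dec (u ⊆? c) ×-dec ¬? (x ∈? c))

    lookup-cm : ∀ u x → lookup (cm φ u) x ≡ not (does (escapes? u x))
    lookup-cm u x = lookup∘tabulate _ x

  ∈cm⁺ : ∀ {u x} → (∀ c → T (φ c) → u ⊆ c → x ∈ c) → x ∈ cm φ u
  ∈cm⁺ {u} {x} x∈classes = lookup⇒[]= x (cm φ u) (trans (lookup-cm u x)
    (cong not (dec-false (escapes? u x) λ (c , φc , u⊆c , x∉c) → x∉c (x∈classes c φc u⊆c))))

  cm-least : ∀ {u} c → T (φ c) → u ⊆ c → cm φ u ⊆ c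
  cm-least {u} c φc u⊆c {x} x∈cm = decidable-stable (x ∈? c) λ x∉c →
    contradiction (trans (sym ([]=⇒lookup x∈cm)) (trans (lookup-cm u x)
      (cong not (dec-true (escapes? u x) (c , φc , u⊆c , x∉c))))) λ ()

  cm-extensive : ∀ u → u ⊆ cm φ u
  cm-extensive u x∈u = ∈cm⁺ λ _ _ u⊆c → u⊆c x∈u

  ⊆cm⇒cm⊆cm : ∀ {u v} → u ⊆ cm φ v → cm φ u ⊆ cm φ v
  ⊆cm⇒cm⊆cm u⊆cmv x∈cmu = ∈cm⁺ λ c φc v⊆c → cm-least c φc (cm-least c φc v⊆c ∘ u⊆cmv) x∈cmu

  cm-monotone : ∀ {u v} → u ⊆ v → cm φ u ⊆ cm φ v
  cm-monotone {v = v} u⊆v = ⊆cm⇒cm⊆cm (cm-extensive v ∘ u⊆v)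

  cm-idempotent : ∀ u → cm φ (cm φ u) ≡ cm φ u
  cm-idempotent u = ⊆-antisym (⊆cm⇒cm⊆cm id) (cm-extensive (cm φ u))

  Equiv⇒⊆cm : ∀ {u v} → Equiv φ u v → u ⊆ cm φ v
  Equiv⇒⊆cm u≈v x∈u = subst (_ ∈_) u≈v (cm-extensive _ x∈u)

  ⊆cm⇒cm∪⊆cm∪ : ∀ {u v} w → u ⊆ cm φ v → cm φ (u ∪ w) ⊆ cm φ (v ∪ w)
  ⊆cm⇒cm∪⊆cm∪ {u} {v} w u⊆cmv = ⊆cm⇒cm⊆cm λ x∈u∪w →
    [ cm-monotone (p⊆p∪q w) ∘ u⊆cmv , cm-extensive (v ∪ w) ∘ q⊆p∪q v w ]′ (x∈p∪q⁻ u w x∈u∪w)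

  flat⇔intersectionOfClasses : ∀ X → Flat (cm φ) X ⇔ IntersectionOfClasses φ X
  flat⇔intersectionOfClasses X = mk⇔ to from
    where
    to : Flat (cm φ) X → IntersectionOfClasses φ X
    to flat = (λ c → T (φ c) × X ⊆ c) , (λ _ → proj₁) , λ x →
      (λ x∈X _ (_ , X⊆c) → X⊆c x∈X) ,
      (λ x∈classes → subst (x ∈_) flat (∈cm⁺ λ c φc X⊆c → x∈classes c (φc , X⊆c)))

    from : IntersectionOfClasses φ X → Flat (cm φ) X
    from (𝓕 , 𝓕-classes , X≡⋂𝓕) = ⊆-antisym
      (λ {x} x∈cm → proj₂ (X≡⋂𝓕 x) λ c c∈𝓕 →
         cm-least c (𝓕-classes c c∈𝓕) (λ {z} z∈X → proj₁ (X≡⋂𝓕 z) z∈X c c∈𝓕) x∈cm)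
      (cm-extensive X)

  x∈cm[u-x]⇒cm[u-x]≡cm[u] : ∀ {u x} → x ∈ cm φ (u - x) → Equiv φ (u - x) u
  x∈cm[u-x]⇒cm[u-x]≡cm[u] {u} {x} x∈cm = ⊆-antisym (cm-monotone (p─q⊆p u ⁅ x ⁆)) (⊆cm⇒cm⊆cm u⊆cm)
    where
    u⊆cm : u ⊆ cm φ (u - x)
    u⊆cm {z} z∈u with z ≟ x
    ... | yes refl = x∈cm
    ... | no  z≢x  = cm-extensive (u - x) (x∈p∧x≢y⇒x∈p-y z∈u z≢x)

  prime⇒independent : ∀ {I} → Prime φ I → Independent (cm φ) I
  prime⇒independent (_ , minimal) x x∈I x∈cm =
    minimal _ (x∈p⇒p-x⊂p x∈I) (x∈cm[u-x]⇒cm[u-x]≡cm[u] x∈cm)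

  independent⇒prime : ∀ {I} → Nonempty I → Independent (cm φ) I → Prime φ I
  independent⇒prime I≢∅ I-indep = I≢∅ , λ v (v⊆I , x , x∈I , x∉v) v≈I →
    I-indep x x∈I (cm-monotone (λ z∈v → x∈p∧x≢y⇒x∈p-y (v⊆I z∈v) λ { refl → x∉v z∈v })
                               (Equiv⇒⊆cm (sym v≈I) x∈I))

  independent-∪⁅⁆⇒∉cm : ∀ {J y} → Independent (cm φ) (J ∪ ⁅ y ⁆) → y ∉ J → y ∉ cm φ J
  independent-∪⁅⁆⇒∉cm {J} {y} indep y∉J y∈cm = indep y (q⊆p∪q J ⁅ y ⁆ (x∈⁅x⁆ y))
    (cm-monotone (λ z∈J → x∈p∧x≢y⇒x∈p-y (p⊆p∪q ⁅ y ⁆ z∈J) λ { refl → y∉J z∈J }) y∈cm)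

  record Basis (u : Subset n) : Set where
    field
      set         : Subset n
      set⊆        : set ⊆ u
      independent : Independent (cm φ) set
      spans       : Equiv φ set u

  basis : ∀ u → Basis u
  basis u = go u (<-wellFounded ∣ u ∣)
    where
    go : ∀ u → Acc _<_ ∣ u ∣ → Basis u
    go u (acc smaller) with any? (λ x → x ∈? u ×-dec x ∈? cm φ (u - x))
    ... | no  u-indep = record
      { set = u ; set⊆ = id ; independent = λ x x∈u x∈cm → u-indep (x , x∈u , x∈cm) ; spans = refl }
    ... | yes (x , x∈u , x∈cm) = record
      { set         = B.set
      ; set⊆        = p─q⊆p u ⁅ x ⁆ ∘ B.set⊆
      ; independent = B.independent
      ; spans       = trans B.spans (x∈cm[u-x]⇒cm[u-x]≡cm[u] x∈cm)
      }
      where module B = Basis (go (u - x) (smaller (x∈p⇒∣p-x∣<∣p∣ x∈u)))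

  IsDim-unique : ∀ {u j k} → IsDim φ u j → IsDim φ u k → j ≡ k
  IsDim-unique (v , v-axial , v≈u , refl) (w , w-axial , w≈u , refl) =
    ≤-antisym (proj₂ w-axial v (proj₁ v-axial) (trans v≈u (sym w≈u)))
              (proj₂ v-axial w (proj₁ w-axial) (trans w≈u (sym v≈u)))

module MaximalGeometricalSystem {φ : Classes n} (system : GeometricalSystem φ) (E-maximal : Maximal φ ⊤) where
  open Closure φ
  open GeometricalSystem system

  Nonempty-cm⇒Nonempty : ∀ {u} → Nonempty (cm φ u) → Nonempty u
  Nonempty-cm⇒Nonempty {u} (x , x∈cm) with nonempty? u
  ... | yes u≢∅ = u≢∅
  ... | no  u≡∅ = contradiction (subst (x ∈_) (trans (cong (cm φ) (Empty-unique u≡∅)) axν₂) x∈cm) ∉⊥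

  simple : Simple (cm φ)
  simple I ∣I∣≤2 x x∈I x∈cm with nonempty? (I - x)
  ... | no  I-x≡∅ = contradiction (x , x∈cm) (I-x≡∅ ∘ Nonempty-cm⇒Nonempty)
  ... | yes (y , y∈I-x) = proj₂ (x∈p─q⁻ I ⁅ x ⁆ y∈I-x) (subst (_∈ ⁅ x ⁆) x≡y (x∈⁅x⁆ x))
    where
    ⁅y⁆≡I-x : ⁅ y ⁆ ≡ I - x
    ⁅y⁆≡I-x = p⊆q∧∣q∣≤∣p∣⇒p≡q (λ z∈⁅y⁆ → subst (_∈ I - x) (sym (x∈⁅y⁆⇒x≡y y z∈⁅y⁆)) y∈I-x)
      (subst (∣ I - x ∣ ≤_) (sym (∣⁅x⁆∣≡1 y)) (≤-pred (<-≤-trans (x∈p⇒∣p-x∣<∣p∣ x∈I) ∣I∣≤2)))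

    x≡y : x ≡ y
    x≡y = x∈⁅y⁆⇒x≡y y (cm-least ⁅ y ⁆ (axμ y) (⊆-reflexive (sym ⁅y⁆≡I-x)) x∈cm)

  singleton-axial : ∀ x → Axial φ ⁅ x ⁆
  singleton-axial x = independent⇒prime (x , x∈⁅x⁆ x) (simple ⁅ x ⁆ ∣⁅x⁆∣≤2) , λ v _ v≈⁅x⁆ →
    p⊆q⇒∣p∣≤∣q∣ (cm-least ⁅ x ⁆ (axμ x) id ∘ Equiv⇒⊆cm v≈⁅x⁆)
    where
    ∣⁅x⁆∣≤2 : ∣ ⁅ x ⁆ ∣ ≤ 2
    ∣⁅x⁆∣≤2 = subst (_≤ 2) (sym (∣⁅x⁆∣≡1 x)) (s≤s z≤n)

  spanning-axial-card-≤ : ∀ {B X} → Axial φ B → Equiv φ B ⊤ → B ⊆ cm φ X → ∣ B ∣ ≤ ∣ X ∣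
  spanning-axial-card-≤ {B} {X} B-axial B≈E B⊆cmX =
    ≤-trans (proj₂ S-axial B (proj₁ B-axial) (trans B≈E (sym S≈E))) (p⊆q⇒∣p∣≤∣q∣ set⊆)
    where
    open Basis (basis X)
    X≈E : Equiv φ X ⊤
    X≈E = ⊆-antisym (cm-monotone ⊆⊤) (subst (_⊆ cm φ X) B≈E (⊆cm⇒cm⊆cm B⊆cmX))
    S≈E : Equiv φ set ⊤
    S≈E = trans spans X≈E
    S≢∅ : Nonempty set
    S≢∅ = let (x , x∈B) = proj₁ (proj₁ B-axial) in
      Nonempty-cm⇒Nonempty (x , subst (x ∈_) (sym spans) (B⊆cmX x∈B))
    S-axial : Axial φ set
    S-axial = proj₂ E-maximal set ⊆⊤ (independent⇒prime S≢∅ independent) S≈E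

  axial-card-≤ : ∀ {A p} → Axial φ A → A ⊆ cm φ p → ∣ A ∣ ≤ ∣ p ∣
  axial-card-≤ {A} {p} A-axial A⊆cmp with axπ ⊤ A (λ _ → cm-extensive ⊤ ∈⊤) A-axial
  ... | w , B-axial , B≈E = +-cancelˡ-≤ (∣ B ─ A ∣) (∣ A ∣) (∣ p ∣) (begin
    ∣ B ─ A ∣ + ∣ A ∣      ≡⟨ q⊆p⇒∣p─q∣+∣q∣≡∣p∣ B A (p⊆p∪q w) ⟩
    ∣ B ∣                  ≤⟨ spanning-axial-card-≤ B-axial B≈E B⊆cmT ⟩
    ∣ (B ─ A) ∪ p ∣        ≤⟨ ∣p∪q∣≤∣p∣+∣q∣ (B ─ A) p ⟩
    ∣ B ─ A ∣ + ∣ p ∣      ∎)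
    where
    open ≤-Reasoning
    B : Subset n
    B = A ∪ w
    B⊆cmT : B ⊆ cm φ ((B ─ A) ∪ p)
    B⊆cmT {z} z∈B with z ∈? A
    ... | yes z∈A = cm-monotone (q⊆p∪q (B ─ A) p) (A⊆cmp z∈A)
    ... | no  z∉A = cm-extensive _ (p⊆p∪q p (x∈p∧x∉q⇒x∈p─q z∈B z∉A))

  prime⇒axial : ∀ {p} → Prime φ p → Axial φ p
  prime⇒axial {p} p-prime@((x , x∈p) , _) =
    let (_ , A-axial , A≈p) = axπ p ⁅ x ⁆ ⁅x⁆⊆cmp (singleton-axial x) in
    p-prime , λ q q-prime q≈p →
      ≤-trans (proj₂ A-axial q q-prime (trans q≈p (sym A≈p))) (axial-card-≤ A-axial (Equiv⇒⊆cm A≈p))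
    where
    ⁅x⁆⊆cmp : ⁅ x ⁆ ⊆ cm φ p
    ⁅x⁆⊆cmp z∈⁅x⁆ = subst (_∈ cm φ p) (sym (x∈⁅y⁆⇒x≡y x z∈⁅x⁆)) (cm-extensive p x∈p)

  independent⇒axial : ∀ {I} → Nonempty I → Independent (cm φ) I → Axial φ I
  independent⇒axial I≢∅ = prime⇒axial ∘ independent⇒prime I≢∅

  independent-card-≤ : ∀ {J X} → Independent (cm φ) J → J ⊆ cm φ X → ∣ J ∣ ≤ ∣ X ∣
  independent-card-≤ {J} {X} J-indep J⊆cmX with nonempty? J
  ... | yes J≢∅ = axial-card-≤ (independent⇒axial J≢∅ J-indep) J⊆cmX
  ... | no  J≡∅ = subst (_≤ ∣ X ∣) (sym (trans (cong ∣_∣ (Empty-unique J≡∅)) (∣⊥∣≡0 n))) z≤n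

  independent-augment : ∀ {I u} → Independent (cm φ) I → I ⊆ cm φ u →
    ∃ λ W → I ⊆ W × Independent (cm φ) W × Equiv φ W u
  independent-augment {I} {u} I-indep I⊆cmu with nonempty? I
  ... | yes I≢∅ =
    let (w , W-axial , W≈u) = axπ u I I⊆cmu (independent⇒axial I≢∅ I-indep)
    in I ∪ w , p⊆p∪q w , prime⇒independent (proj₁ W-axial) , W≈u
  ... | no  I≡∅ = set , (λ x∈I → contradiction (_ , x∈I) I≡∅) , independent , spans
    where open Basis (basis u)

  independent-∪⁅⁆ : ∀ {I y} → Independent (cm φ) I → y ∉ cm φ I → Independent (cm φ) (I ∪ ⁅ y ⁆)
  independent-∪⁅⁆ {I} {y} I-indep y∉cmI
    with independent-augment I-indep (cm-extensive (I ∪ ⁅ y ⁆) ∘ p⊆p∪q ⁅ y ⁆)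
  ... | W , I⊆W , W-indep , W≈X =
    subst (Independent (cm φ)) (p⊆q∧∣q∣≤∣p∣⇒p≡q set⊆ ∣X∣≤∣S∣) independent
    where
    open Basis (basis (I ∪ ⁅ y ⁆))
    open ≤-Reasoning

    ∣I∣<∣W∣ : ∣ I ∣ < ∣ W ∣
    ∣I∣<∣W∣ = ≰⇒> λ ∣W∣≤∣I∣ → y∉cmI (subst (λ V → y ∈ cm φ V) (sym (p⊆q∧∣q∣≤∣p∣⇒p≡q I⊆W ∣W∣≤∣I∣))
      (Equiv⇒⊆cm (sym W≈X) (q⊆p∪q I ⁅ y ⁆ (x∈⁅x⁆ y))))

    ∣X∣≤∣S∣ : ∣ I ∪ ⁅ y ⁆ ∣ ≤ ∣ set ∣
    ∣X∣≤∣S∣ = begin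
      ∣ I ∪ ⁅ y ⁆ ∣       ≤⟨ ∣p∪q∣≤∣p∣+∣q∣ I ⁅ y ⁆ ⟩
      ∣ I ∣ + ∣ ⁅ y ⁆ ∣   ≡⟨ cong (∣ I ∣ +_) (∣⁅x⁆∣≡1 y) ⟩
      ∣ I ∣ + 1           ≡⟨ +-comm ∣ I ∣ 1 ⟩
      suc ∣ I ∣           ≤⟨ ∣I∣<∣W∣ ⟩
      ∣ W ∣               ≤⟨ independent-card-≤ W-indep (Equiv⇒⊆cm (trans W≈X (sym spans))) ⟩
      ∣ set ∣             ∎

  -- A basis I of X extends by y and then by x to an independent set, although
  -- y ∈ cm (I ∪ ⁅ x ⁆).
  cm-exchange : ∀ X x y → y ∈ cm φ (X ∪ ⁅ x ⁆) → y ∉ cm φ X → x ∈ cm φ (X ∪ ⁅ y ⁆)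
  cm-exchange X x y y∈cm[X∪x] y∉cmX with x ∈? cm φ (X ∪ ⁅ y ⁆)
  ... | yes x∈cm[X∪y] = x∈cm[X∪y]
  ... | no  x∉cm[X∪y] = contradiction (⊆cm⇒cm∪⊆cm∪ ⁅ x ⁆ (Equiv⇒⊆cm (sym spans)) y∈cm[X∪x])
                                      (independent-∪⁅⁆⇒∉cm Ixy-indep y∉I∪x)
    where
    open Basis (basis X)
    y∉cmI : y ∉ cm φ set
    y∉cmI = y∉cmX ∘ subst (y ∈_) spans

    Iyx-indep : Independent (cm φ) ((set ∪ ⁅ y ⁆) ∪ ⁅ x ⁆)
    Iyx-indep = independent-∪⁅⁆ (independent-∪⁅⁆ independent y∉cmI)
      (x∉cm[X∪y] ∘ ⊆cm⇒cm∪⊆cm∪ ⁅ y ⁆ (cm-extensive X ∘ set⊆))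

    Ixy-indep : Independent (cm φ) ((set ∪ ⁅ x ⁆) ∪ ⁅ y ⁆)
    Ixy-indep = subst (Independent (cm φ)) (begin
      (set ∪ ⁅ y ⁆) ∪ ⁅ x ⁆   ≡⟨ ∪-assoc set ⁅ y ⁆ ⁅ x ⁆ ⟩
      set ∪ (⁅ y ⁆ ∪ ⁅ x ⁆)   ≡⟨ cong (set ∪_) (∪-comm ⁅ y ⁆ ⁅ x ⁆) ⟩
      set ∪ (⁅ x ⁆ ∪ ⁅ y ⁆)   ≡⟨ sym (∪-assoc set ⁅ x ⁆ ⁅ y ⁆) ⟩
      (set ∪ ⁅ x ⁆) ∪ ⁅ y ⁆   ∎) Iyx-indep
      where open ≡-Reasoning

    y∉I∪x : y ∉ set ∪ ⁅ x ⁆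
    y∉I∪x y∈I∪x with x∈p∪q⁻ set ⁅ x ⁆ y∈I∪x
    ... | inj₁ y∈I   = y∉cmI (cm-extensive set y∈I)
    ... | inj₂ y∈⁅x⁆ rewrite x∈⁅y⁆⇒x≡y x y∈⁅x⁆ = x∉cm[X∪y] (cm-extensive _ (q⊆p∪q X ⁅ x ⁆ (x∈⁅x⁆ x)))

  isMatroidClosure : IsMatroidClosure (cm φ)
  isMatroidClosure = record
    { extensive  = cm-extensive
    ; monotone   = λ _ _ → cm-monotone
    ; idempotent = cm-idempotent
    ; exchange   = cm-exchange
    }

  independent⇔axial⊎⊥ : ∀ I → Independent (cm φ) I ⇔ (Axial φ I ⊎ I ≡ ⊥)
  independent⇔axial⊎⊥ I = mk⇔ to from
    where
    to : Independent (cm φ) I → Axial φ I ⊎ I ≡ ⊥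
    to I-indep with nonempty? I
    ... | yes I≢∅ = inj₁ (independent⇒axial I≢∅ I-indep)
    ... | no  I≡∅ = inj₂ (Empty-unique I≡∅)

    from : Axial φ I ⊎ I ≡ ⊥ → Independent (cm φ) I
    from (inj₁ I-axial) = prime⇒independent (proj₁ I-axial)
    from (inj₂ refl)    = λ _ x∈⊥ → contradiction x∈⊥ ∉⊥

  isRank⇔isDim : ∀ {u} → Nonempty u → ∀ k → IsRank (cm φ) u k ⇔ IsDim φ u k
  isRank⇔isDim {u} (x , x∈u) _ = mk⇔
    (λ rank-k → subst (IsDim φ u) (IsRank-unique (cm φ) rank-S rank-k) dim-S)
    (λ dim-k → subst (IsRank (cm φ) u) (IsDim-unique dim-S dim-k) rank-S)
    where
    open Basis (basis u)
    rank-S : IsRank (cm φ) u ∣ set ∣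
    rank-S = (set , set⊆ , independent , refl) , λ J J⊆u J-indep →
      independent-card-≤ J-indep (Equiv⇒⊆cm (sym spans) ∘ J⊆u)
    dim-S : IsDim φ u ∣ set ∣
    dim-S = set , independent⇒axial (Nonempty-cm⇒Nonempty (x , Equiv⇒⊆cm (sym spans) x∈u)) independent
              , spans , refl

theorem1 : (n : ℕ) (φ : Classes n) → GeometricalSystem φ → Maximal φ ⊤ →
    IsMatroidClosure (cm φ)
    × Simple (cm φ)
    × (∀ X → Flat (cm φ) X ⇔ IntersectionOfClasses φ X)
    × (∀ I → Independent (cm φ) I ⇔ (Axial φ I ⊎ I ≡ ⊥))
    × (∀ u → Nonempty u → ∀ k → IsRank (cm φ) u k ⇔ IsDim φ u k)
theorem1 n φ system E-maximal =
  isMatroidClosure , simple , flat⇔intersectionOfClasses , independent⇔axial⊎⊥ , λ _ → isRank⇔isDim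
  where
  open Closure φ
  open MaximalGeometricalSystem system E-maximal
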